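{- Let $P$ be a poset and let $f\colon P\to P$ be an order-preserving map. (a) Suppose that $\textup{mxl}(P)$ is a cutset of $P$. If $C\in \mathscr{D}(P)$ is a fixed point of the map $\mathscr{D}(f)$ and the subposet $C$ has the fixed point property, then $f$ has a fixed point in $C$. (b) Suppose that both $\textup{mxl}(P)$ and $\textup{mnl}(P)$ are cutsets of $P$ and that $\mathscr{D}(P)\cap\mathscr{U}(P)=\varnothing$. If $C\in \mathscr{C}(P)$ is a fixed point of the map $\mathscr{C}(f)$ and the subposet $C$ has the fixed point property, then $f$ has a fixed point in $C$.
   Context: A poset has the fixed point property if every order-preserving self-map of it has a fixed point. A subset $X$ of a poset $P$ is a cutset if every maximal chain of $P$ intersects $X$. $\textup{mxl}(P)$, $\textup{mnl}(P)$ denote the sets of maximal and minimal elements. A subset is connected if it is non-empty and connected with respect to the comparability relation; connected components are maximal connected subsets. For non-empty $A\subseteq \textup{mxl}(P)$ let $L(A)=\{x\in P: x\le a\ \forall a\in A\}$; for non-empty $A\subseteq\textup{mnl}(P)$ let $U(A)=\{x\in P: x\ge a\ \forall a\in A\}$. $\mathscr{D}(P)$ is the set of connected components of the non-empty sets $L(A)$ ($A\subseteq\textup{mxl}(P)$ non-empty), ordered by inclusion; $\mathscr{U}(P)$ is the set of connected components of the non-empty sets $U(A)$ ($A\subseteq\textup{mnl}(P)$ non-empty), ordered by reverse inclusion. $\mathscr{C}(P)$ is the union of the posets $\mathscr{D}(P)$ and $\mathscr{U}(P)$ with the additional relations $C_1\le C_2$ for every $(C_1,C_2)\in\mathscr{U}(P)\times\mathscr{D}(P)$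 with $C_1\cap C_2\neq\varnothing$. For an order-preserving $f\colon P\to P$: if $\textup{mxl}(P)$ is a cutset, $\mathscr{D}(f)\colon\mathscr{D}(P)\to\mathscr{D}(P)$ is $\mathscr{D}(f)(C)=\min\{D\in\mathscr{D}(P): f(C)\subseteq D\}$ (minimum with respect to inclusion; it exists); if $\textup{mnl}(P)$ is a cutset, $\mathscr{U}(f)\colon\mathscr{U}(P)\to\mathscr{U}(P)$ is $\mathscr{U}(f)(C)=\max\{D\in\mathscr{U}(P): f(C)\subseteq D\}$ (maximum in the order of $\mathscr{U}(P)$, i.e. the smallest such set under inclusion; it exists); if both are cutsets and $\mathscr{D}(P)\cap\mathscr{U}(P)=\varnothing$, $\mathscr{C}(f)\colon\mathscr{C}(P)\to\mathscr{C}(P)$ equals $\mathscr{D}(f)$ on $\mathscr{D}(P)$ and $\mathscr{U}(f)$ on $\mathscr{U}(P)$. -}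

module Defs where

open import Level using (Level; _⊔_; suc)
open import Data.Product using (Σ; ∃; _×_; _,_; proj₁; proj₂)
open import Data.Sum using (_⊎_)
open import Relation.Nullary using (¬_)
open import Relation.Binary.Core using (Rel)
open import Relation.Binary.Structures using (IsPartialOrder)
open import Relation.Binary.PropositionalEquality using (_≡_)

record Poset (c ℓ : Level) : Set (Level.suc (c ⊔ ℓ)) where
  field
    Carrier        : Set c
    _≤_            : Rel Carrier ℓ
    isPartialOrder : IsPartialOrder _≡_ _≤_

module PosetNotions {c ℓ : Level} (P : Poset c ℓ) where
  open Poset P

  Subset : Set (Level.suc (c ⊔ ℓ))
  Subset = Carrier → Set (c ⊔ ℓ)

  _⊆_ : Subset → Subset → Set (c ⊔ ℓ)
  S ⊆ T = ∀ x → S x → T x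

  _≐_ : Subset → Subset → Set (c ⊔ ℓ)
  S ≐ T = (S ⊆ T) × (T ⊆ S)

  NonEmpty : Subset → Set (c ⊔ ℓ)
  NonEmpty S = Σ Carrier S

  Comparable : Carrier → Carrier → Set ℓ
  Comparable x y = (x ≤ y) ⊎ (y ≤ x)

  OrderPreserving : (Carrier → Carrier) → Set (c ⊔ ℓ)
  OrderPreserving f = ∀ x y → x ≤ y → f x ≤ f y

  Chain : Subset → Set (c ⊔ ℓ)
  Chain S = ∀ x y → S x → S y → Comparable x y

  MaximalChain : Subset → Set (Level.suc (c ⊔ ℓ))
  MaximalChain S = Chain S × (∀ T → Chain T → S ⊆ T → T ⊆ S)

  Cutset : Subset → Set (Level.suc (c ⊔ ℓ))
  Cutset X = ∀ M → MaximalChain M → Σ Carrier (λ x → M x × X x)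

  mxl : Subset
  mxl x = ∀ y → x ≤ y → x ≡ y

  mnl : Subset
  mnl x = ∀ y → y ≤ x → x ≡ y

  L : Subset → Subset
  L A x = ∀ a → A a → x ≤ a

  U : Subset → Subset
  U A x = ∀ a → A a → a ≤ x

  data Zigzag (S : Subset) : Carrier → Carrier → Set (c ⊔ ℓ) where
    here : ∀ {x} → S x → Zigzag S x x
    step : ∀ {x y z} → S x → Comparable x y → Zigzag S y z → Zigzag S x z

  Connected : Subset → Set (c ⊔ ℓ)
  Connected S = NonEmpty S × (∀ x y → S x → S y → Zigzag S x y)

  Component : Subset → Subset → Set (Level.suc (c ⊔ ℓ))
  Component S C = (C ⊆ S) × Connected C
                  × (∀ T → Connected T → C ⊆ T → T ⊆ S → T ⊆ C)

  InD : Subset → Set (Level.suc (c ⊔ ℓ))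
  InD C = Σ Subset (λ A → (A ⊆ mxl) × NonEmpty A × NonEmpty (L A) × Component (L A) C)

  InU : Subset → Set (Level.suc (c ⊔ ℓ))
  InU C = Σ Subset (λ A → (A ⊆ mnl) × NonEmpty A × NonEmpty (U A) × Component (U A) C)

  ImageIn : (Carrier → Carrier) → Subset → Subset → Set (c ⊔ ℓ)
  ImageIn f C D = ∀ x → C x → D (f x)

  DfValue : (Carrier → Carrier) → Subset → Subset → Set (Level.suc (c ⊔ ℓ))
  DfValue f C D = InD D × ImageIn f C D × (∀ D' → InD D' → ImageIn f C D' → D ⊆ D')

  -- 𝒰(f)(C) = D : D is the maximum in 𝒰(P) (reverse inclusion), i.e. the
  -- smallest under inclusion, of {D ∈ 𝒰(P) : f(C) ⊆ D}
  UfValue : (Carrier → Carrier) → Subset → Subset → Set (Level.suc (c ⊔ ℓ))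
  UfValue f C D = InU D × ImageIn f C D × (∀ D' → InU D' → ImageIn f C D' → D ⊆ D')

  DUDisjoint : Set (Level.suc (c ⊔ ℓ))
  DUDisjoint = ∀ C D → InD C → InU D → ¬ (C ≐ D)

  -- C is a fixed point of 𝒞(f) (with C ∈ 𝒞(P) = 𝒟(P) ∪ 𝒰(P))
  CfFixed : (Carrier → Carrier) → Subset → Set (Level.suc (c ⊔ ℓ))
  CfFixed f C = (InD C × DfValue f C C) ⊎ (InU C × UfValue f C C)

  FPP : Subset → Set (c ⊔ ℓ)
  FPP C = (g : Σ Carrier C → Σ Carrier C)
        → (∀ x y → proj₁ x ≤ proj₁ y → proj₁ (g x) ≤ proj₁ (g y))
        → Σ (Σ Carrier C) (λ x → proj₁ (g x) ≡ proj₁ x)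

  HasFixedPointIn : (Carrier → Carrier) → Subset → Set (c ⊔ ℓ)
  HasFixedPointIn f C = Σ Carrier (λ x → C x × f x ≡ x)

module Submission where

open import Defs
open import Data.Product using (_×_; _,_)
open import Data.Sum using (inj₁; inj₂)

-- A fixed point C of 𝒟(f) or 𝒰(f) is in particular f-invariant, and an
-- order-preserving map restricts to an order-preserving self-map of any
-- invariant subposet; the fixed point property of C does the rest.
-- The cutset and disjointness hypotheses only serve to make 𝒟(f), 𝒰(f) and
-- 𝒞(f) well defined; given the value relations they are not needed.

module _ {c ℓ} (P : Poset c ℓ) where
  open PosetNotions P

  fixedPoint-of-invariant : ∀ {f C} → OrderPreserving f → ImageIn f C C → FPP C →
                            HasFixedPointIn f C
  fixedPoint-of-invariant {f} mono f[C]⊆C fpp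
    with fpp (λ (x , x∈C) → f x , f[C]⊆C x x∈C) (λ (x , _) (y , _) → mono x y)
  ... | (x , x∈C) , fx≡x = x , x∈C , fx≡x

  DfValue-image : ∀ {f C D} → DfValue f C D → ImageIn f C D
  DfValue-image (_ , f[C]⊆D , _) = f[C]⊆D

  UfValue-image : ∀ {f C D} → UfValue f C D → ImageIn f C D
  UfValue-image (_ , f[C]⊆D , _) = f[C]⊆D

  CfFixed-invariant : ∀ {f C} → CfFixed f C → ImageIn f C C
  CfFixed-invariant (inj₁ (_ , value)) = DfValue-image value
  CfFixed-invariant (inj₂ (_ , value)) = UfValue-image value

mainTheorem2 : ∀ {c ℓ} (P : Poset c ℓ) → let open PosetNotions P in
    (f : Poset.Carrier P → Poset.Carrier P) → OrderPreserving f →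
    ((C : Subset) → Cutset mxl → InD C → DfValue f C C → FPP C → HasFixedPointIn f C)
    × ((C : Subset) → Cutset mxl → Cutset mnl → DUDisjoint → CfFixed f C → FPP C → HasFixedPointIn f C)
mainTheorem2 P f mono =
    (λ C _ _ value → fixedPoint-of-invariant P mono (DfValue-image P value))
  , (λ C _ _ _ fixed → fixedPoint-of-invariant P mono (CfFixed-invariant P fixed))
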